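{- For every $\varepsilon>0$, the competitive ratio of the greedy algorithm for online decomposable weighted bipartite matching with free disposal (defined in the context) is at most $\frac{1}{2-\varepsilon}$. That is, there is an instance (together with a valid choice among tied machines whenever the greedy rule has ties) on which the value obtained by the greedy algorithm is at most $\frac{1}{2-\varepsilon}$ times the optimal offline value.
   Context: Problem (online decomposable weighted bipartite matching with free disposal). A finite set $V_1$ of machines with speeds $s:V_1\to\mathbb{R}_{>0}$ is known in advance. Jobs $v$ with sizes $w(v)>0$ arrive one at a time; when $v$ arrives, $w(v)$ is revealed and the algorithm must immediately and irrevocably assign $v$ to a machine (every job may be assigned to every machine, i.e. the bipartite graph is complete, and a machine may receive several jobs). The edge weight between machine $u$ and job $v$ is $s(u)\,w(v)$. At the end, each machine $u$ earns $s(u)$ times the maximum size of a job assigned to it (0 if none), and the algorithm's value is the sum of these earnings. $\mathrm{OPT}$ is the maximum value over all offline assignments. The competitive ratio of an algorithm is the infimum over instances of (its value)/$\mathrm{OPT}$. Greedy algorithm: when a job $v$ arrives, for every machine $u$ compute $s(u)w(v)-s(u)w(v')$, where $v'$ is the largest job currently assigned to $u$ (the subtracted term is $0$ if $u$ has no job); if this difference is positive for at least one machine, assign $v$ to a machine with maximum difference (ties among such machines broken arbitrarily).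
   Formalization: The parameter ε ranges over the positive rationals, and the machine speeds and job sizes of the constructed instance are taken in the positive rationals. -}

module Defs where

open import Data.Nat using (ℕ; zero; suc)
open import Data.Fin using (Fin; zero; suc; _≟_)
open import Data.Maybe using (Maybe; just; nothing)
open import Data.Vec using (Vec; []; _∷_)
open import Data.Product using (_×_)
open import Data.Rational using (ℚ; 0ℚ; _+_; _*_; _-_; _≤_; _<_; _⊔_)
open import Relation.Nullary using (yes; no)

-- A "load" records, for each machine, the size of the largest job
-- assigned to it so far (0 if none; all job sizes are positive).
Load : ℕ → Set
Load m = Fin m → ℚ

emptyLoad : ∀ {m} → Load m
emptyLoad _ = 0ℚ

sumFin : (m : ℕ) → (Fin m → ℚ) → ℚ
sumFin zero    f = 0ℚ
sumFin (suc m) f = f zero + sumFin m (λ i → f (suc i))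

value : ∀ {m} → (Fin m → ℚ) → Load m → ℚ
value {m} s L = sumFin m (λ u → s u * L u)

update : ∀ {m} → Load m → ℚ → Maybe (Fin m) → Load m
update L w nothing  u' = L u'
update L w (just u) u' with u' ≟ u
... | yes _ = L u' ⊔ w
... | no  _ = L u'

gain : ∀ {m} → (Fin m → ℚ) → Load m → ℚ → Fin m → ℚ
gain s L w u = s u * w - s u * L u

data GreedyChoice {m} (s : Fin m → ℚ) (L : Load m) (w : ℚ) : Maybe (Fin m) → Set where
  skip   : (∀ u → gain s L w u ≤ 0ℚ) → GreedyChoice s L w nothing
  assign : ∀ u → 0ℚ < gain s L w u → (∀ u' → gain s L w u' ≤ gain s L w u)
         → GreedyChoice s L w (just u)

data GreedyRun {m} (s : Fin m → ℚ) : ∀ {n} → Load m → Vec ℚ n → Load m → Set where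
  done : ∀ {L} → GreedyRun s L [] L
  step : ∀ {n L w d L'} {ws : Vec ℚ n} → GreedyChoice s L w d
       → GreedyRun s (update L w d) ws L' → GreedyRun s L (w ∷ ws) L'

offline : ∀ {m n} → Load m → Vec ℚ n → Vec (Maybe (Fin m)) n → Load m
offline L []       []       = L
offline L (w ∷ ws) (d ∷ ds) = offline (update L w d) ws ds

module Submission where

-- The instance, for a small x > 0 and a = 1 - x: one fast machine of speed 1
-- and n slow machines of speed x; jobs of sizes a^n, a^(n-1), ..., a, 1 arrive
-- in this order.  When a job w arrives while the fast machine holds a·w, the
-- gain on the fast machine is w - a·w = x·w, exactly the gain on an empty slow
-- machine, so greedy may keep everything on the fast machine and earns 1.
-- Offline, job a^j goes to machine j, earning 1 + x·(a + ... + a^n)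
-- = 1 + a - a^(n+1) (a geometric sum).  By Bernoulli's inequality
-- a^k·(1 + k·x) ≤ 1, so a^(n+1) ≤ x once (n+1)·x² ≥ 1, which holds for some n
-- by the Archimedean property; the offline value is then at least 2 - 2x.

open import Defs
open import Function using (_∘_)
import Data.Nat as ℕ
open import Data.Nat using (ℕ; zero; suc; z≤n; s≤s)
import Data.Nat.Properties as ℕP
open import Data.Fin using (Fin; zero; suc; toℕ; _≟_)
open import Data.Fin.Properties using (toℕ≤pred[n])
open import Data.Maybe using (Maybe; just)
open import Data.Vec using (Vec; []; _∷_)
open import Data.Vec.Relation.Unary.All using (All; []; _∷_)
open import Data.Product using (Σ; _×_; _,_)
open import Data.Sum using (inj₁; inj₂)
open import Data.Empty using (⊥-elim)
open import Relation.Nullary using (yes; no)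
open import Relation.Binary.PropositionalEquality
open import Algebra.Bundles using (CommutativeRing)
import Data.Integer as ℤ
open import Data.Integer using (+[1+_]; -[1+_]; +≤+; +<+)
open import Agda.Builtin.Int using (pos)
import Data.Integer.Properties as ℤP
open import Data.Rational
  using (ℚ; mkℚ; 0ℚ; 1ℚ; ½; _+_; _*_; _-_; -_; 1/_; _⊔_; _≤_; _<_; *≤*; *<*; positive; nonNegative)
open import Data.Rational.Literals using (fromℤ)
open import Data.Rational.Properties hiding (_≟_)
import Data.Rational.Unnormalised as ℚᵘ
import Data.Rational.Unnormalised.Properties as ℚᵘP
open import Data.Rational.Solver using (module +-*-Solver)
open +-*-Solver using (solve; _:=_; _:+_; _:*_; _:-_; con)
open CommutativeRing +-*-commutativeRing using (semiring)
open import Algebra.Properties.Semiring.Mult semiring using (×-assoc-*) renaming (_×_ to _·_)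
open import Algebra.Properties.Semiring.Exp semiring using (_^_)

-- Elementary order facts in ℚ, phrased with 0ℚ ≤ _ instead of instances.

*-nonneg : ∀ {p q} → 0ℚ ≤ p → 0ℚ ≤ q → 0ℚ ≤ p * q
*-nonneg {p} {q} 0≤p 0≤q =
  nonNegative⁻¹ (p * q) {{nonNeg*nonNeg⇒nonNeg p {{nonNegative 0≤p}} q {{nonNegative 0≤q}}}}

*-pos : ∀ {p q} → 0ℚ < p → 0ℚ < q → 0ℚ < p * q
*-pos {p} {q} 0<p 0<q = positive⁻¹ (p * q) {{pos*pos⇒pos p {{positive 0<p}} q {{positive 0<q}}}}

sub-antimonoʳ : ∀ p {q r} → q ≤ r → p - r ≤ p - q
sub-antimonoʳ p q≤r = +-monoʳ-≤ p (neg-antimono-≤ q≤r)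

p≤q+p : ∀ p {q} → 0ℚ ≤ q → p ≤ q + p
p≤q+p p {q} 0≤q = ≤-trans (≤-reflexive (sym (+-identityˡ p))) (+-monoˡ-≤ p 0≤q)

0<1 : 0ℚ < 1ℚ
0<1 = positive⁻¹ 1ℚ

0≤1-x : ∀ {x} → x ≤ 1ℚ → 0ℚ ≤ 1ℚ - x
0≤1-x {x} x≤1 = ≤-trans (≤-reflexive (sym (+-inverseʳ x))) (+-monoˡ-≤ (- x) x≤1)

·-nonneg : ∀ k {r} → 0ℚ ≤ r → 0ℚ ≤ k · r
·-nonneg zero    0≤r = ≤-refl
·-nonneg (suc k) 0≤r = +-mono-≤ 0≤r (·-nonneg k 0≤r)

^-pos : ∀ {r} → 0ℚ < r → ∀ k → 0ℚ < r ^ k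
^-pos 0<r zero    = 0<1
^-pos 0<r (suc k) = *-pos 0<r (^-pos 0<r k)

^-nonneg : ∀ {r} → 0ℚ ≤ r → ∀ k → 0ℚ ≤ r ^ k
^-nonneg 0≤r zero    = <⇒≤ 0<1
^-nonneg 0≤r (suc k) = *-nonneg 0≤r (^-nonneg 0≤r k)

bernoulli : ∀ {x} → 0ℚ ≤ x → x ≤ 1ℚ → ∀ k → (1ℚ - x) ^ k * (1ℚ + k · x) ≤ 1ℚ
bernoulli 0≤x x≤1 zero = ≤-refl
bernoulli {x} 0≤x x≤1 (suc k) = begin
  (a * P) * (1ℚ + (x + T))     ≡⟨ expand ⟩
  P * (1ℚ + T) - P * (x * (x + T))
    ≤⟨ sub-antimonoʳ (P * (1ℚ + T)) (*-nonneg (^-nonneg (0≤1-x x≤1) k) (*-nonneg 0≤x (+-mono-≤ 0≤x (·-nonneg k 0≤x)))) ⟩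
  P * (1ℚ + T) - 0ℚ            ≡⟨ +-identityʳ (P * (1ℚ + T)) ⟩
  P * (1ℚ + T)                 ≤⟨ bernoulli 0≤x x≤1 k ⟩
  1ℚ                           ∎
  where
  open ≤-Reasoning
  a P T : ℚ
  a = 1ℚ - x
  P = a ^ k
  T = k · x
  expand : (a * P) * (1ℚ + (x + T)) ≡ P * (1ℚ + T) - P * (x * (x + T))
  expand = solve 3 (λ x P T → ((con 1ℚ :- x) :* P) :* (con 1ℚ :+ (x :+ T))
                             := P :* (con 1ℚ :+ T) :- P :* (x :* (x :+ T))) refl x P T

-- Consequence: (1 - x)^k ≤ x as soon as k·x² ≥ 1, because
-- (1 - x)^k ≤ (1 - x)^k · k·x · x ≤ 1 · x.
power-small : ∀ {x} → 0ℚ ≤ x → x ≤ 1ℚ → ∀ k → 1ℚ ≤ k · (x * x) → (1ℚ - x) ^ k ≤ x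
power-small {x} 0≤x x≤1 k 1≤kx² = begin
  P                  ≡⟨ sym (*-identityʳ P) ⟩
  P * 1ℚ             ≤⟨ *-monoˡ-≤-nonNeg P {{nonNegative 0≤P}} 1≤kx² ⟩
  P * (k · (x * x))  ≡⟨ cong (P *_) (sym (×-assoc-* k x x)) ⟩
  P * (T * x)        ≡⟨ sym (*-assoc P T x) ⟩
  (P * T) * x        ≤⟨ *-monoʳ-≤-nonNeg x {{nonNegative 0≤x}} PT≤1 ⟩
  1ℚ * x             ≡⟨ *-identityˡ x ⟩
  x                  ∎
  where
  open ≤-Reasoning
  P T : ℚ
  P = (1ℚ - x) ^ k
  T = k · x
  0≤P : 0ℚ ≤ P
  0≤P = ^-nonneg (0≤1-x x≤1) k
  PT≤1 : P * T ≤ 1ℚ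
  PT≤1 = ≤-trans (*-monoˡ-≤-nonNeg P {{nonNegative 0≤P}} (p≤q+p T (<⇒≤ 0<1)))
                 (bernoulli 0≤x x≤1 k)

-- The Archimedean property: every positive rational has a positive natural
-- multiple that is at least 1.  For r = (p+1)/(d+1) one can take d + 1,
-- since 1/r ≤ d + 1.  This needs the integer literals as sums of ones.

fromℤ-suc : ∀ k → fromℤ (pos (suc k)) ≡ 1ℚ + fromℤ (pos k)
fromℤ-suc k = toℚᵘ-injective
  (ℚᵘP.≃-trans (ℚᵘ.*≡* cross) (ℚᵘP.≃-sym (toℚᵘ-homo-+ 1ℚ (fromℤ (pos k)))))
  where
  cross : pos (suc k) ℤ.* pos 1 ≡ (pos 1 ℤ.* pos 1 ℤ.+ pos k ℤ.* pos 1) ℤ.* pos 1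
  cross = cong (ℤ._* pos 1) (sym (cong (λ z → pos 1 ℤ.+ z) (ℤP.*-identityʳ (pos k))))

·1≡fromℤ : ∀ k → k · 1ℚ ≡ fromℤ (pos k)
·1≡fromℤ zero    = refl
·1≡fromℤ (suc k) = trans (cong (1ℚ +_) (·1≡fromℤ k)) (sym (fromℤ-suc k))

archimedean : ∀ r → 0ℚ < r → Σ ℕ λ K → 1ℚ ≤ suc K · r
archimedean (mkℚ (pos zero) d _) (*<* (+<+ ()))
archimedean (mkℚ -[1+ p ] d _) (*<* ())
archimedean r@(mkℚ +[1+ p ] d _) _ = d , (begin
  1ℚ                       ≡⟨ sym (*-inverseˡ r) ⟩
  1/ r * r                 ≤⟨ *-monoʳ-≤-nonNeg r 1/r≤d+1 ⟩
  fromℤ (pos (suc d)) * r  ≡⟨ cong (_* r) (sym (·1≡fromℤ (suc d))) ⟩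
  (suc d · 1ℚ) * r         ≡⟨ ×-assoc-* (suc d) 1ℚ r ⟩
  suc d · (1ℚ * r)         ≡⟨ cong (suc d ·_) (*-identityˡ r) ⟩
  suc d · r                ∎)
  where
  open ≤-Reasoning
  1/r≤d+1 : 1/ r ≤ fromℤ (pos (suc d))
  1/r≤d+1 = *≤* (+≤+ (ℕP.*-monoʳ-≤ (suc d) (s≤s z≤n)))

sumFin-cong : ∀ m {f g : Fin m → ℚ} → (∀ i → f i ≡ g i) → sumFin m f ≡ sumFin m g
sumFin-cong zero    f≡g = refl
sumFin-cong (suc m) f≡g = cong₂ _+_ (f≡g zero) (sumFin-cong m (f≡g ∘ suc))

sumFin-zero : ∀ m {f : Fin m → ℚ} → (∀ i → f i ≡ 0ℚ) → sumFin m f ≡ 0ℚ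
sumFin-zero zero    f≡0 = refl
sumFin-zero (suc m) f≡0 =
  trans (cong₂ _+_ (f≡0 zero) (sumFin-zero m (f≡0 ∘ suc))) (+-identityˡ 0ℚ)

geometric : ∀ x p n →
  sumFin n (λ i → x * (p * (1ℚ - x) ^ toℕ i)) ≡ p - p * (1ℚ - x) ^ n
geometric x p zero = solve 1 (λ p → con 0ℚ := p :- p :* con 1ℚ) refl p
geometric x p (suc n) = begin
  x * (p * 1ℚ) + sumFin n (λ i → x * (p * (a * a ^ toℕ i)))
    ≡⟨ cong (x * (p * 1ℚ) +_) (sumFin-cong n (λ i → cong (x *_) (sym (*-assoc p a (a ^ toℕ i))))) ⟩
  x * (p * 1ℚ) + sumFin n (λ i → x * ((p * a) * a ^ toℕ i))
    ≡⟨ cong (x * (p * 1ℚ) +_) (geometric x (p * a) n) ⟩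
  x * (p * 1ℚ) + (p * a - p * a * a ^ n)
    ≡⟨ solve 3 (λ x p q → x :* (p :* con 1ℚ) :+ (p :* (con 1ℚ :- x) :- p :* (con 1ℚ :- x) :* q)
                       := p :- p :* ((con 1ℚ :- x) :* q)) refl x p (a ^ n) ⟩
  p - p * (a * a ^ n) ∎
  where
  open ≡-Reasoning
  a : ℚ
  a = 1ℚ - x

countdown : ∀ {A : Set} → (ℕ → A) → (k : ℕ) → Vec A (suc k)
countdown h zero    = h zero ∷ []
countdown h (suc k) = h (suc k) ∷ countdown h k

countdown-all : ∀ {A : Set} {P : A → Set} {h : ℕ → A} → (∀ j → P (h j)) → ∀ k → All P (countdown h k)
countdown-all Ph zero    = Ph zero ∷ []
countdown-all Ph (suc k) = Ph (suc k) ∷ countdown-all Ph k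

update-hit : ∀ {m} (L : Load m) w u → update L w (just u) u ≡ L u ⊔ w
update-hit L w u with u ≟ u
... | yes _  = refl
... | no u≢u = ⊥-elim (u≢u refl)

update-miss : ∀ {m} (L : Load m) w {u v} → u ≢ v → update L w (just v) u ≡ L u
update-miss L w {u} {v} u≢v with u ≟ v
... | yes u≡v = ⊥-elim (u≢v u≡v)
... | no  _   = refl

InjectiveUpTo : ∀ {m} → ℕ → (ℕ → Fin m) → Set
InjectiveUpTo k g = ∀ {i j} → i ℕ.≤ k → j ℕ.≤ k → g i ≡ g j → i ≡ j

module OfflineLoads {m} (f : ℕ → ℚ) (g : ℕ → Fin m) where

  assignment : (k : ℕ) → Vec (Maybe (Fin m)) (suc k)
  assignment = countdown (just ∘ g)

  offline-miss : ∀ k (L : Load m) u → (∀ {j} → j ℕ.≤ k → g j ≢ u) →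
    offline L (countdown f k) (assignment k) u ≡ L u
  offline-miss zero    L u missed = update-miss L (f 0) (missed z≤n ∘ sym)
  offline-miss (suc k) L u missed =
    trans (offline-miss k _ u (missed ∘ ℕP.m≤n⇒m≤1+n))
          (update-miss L (f (suc k)) (missed ℕP.≤-refl ∘ sym))

  distinct : ∀ {k} → InjectiveUpTo (suc k) g → ∀ {i} → i ℕ.≤ k → g i ≢ g (suc k)
  distinct {k} inj i≤k gi≡g1+k =
    ℕP.1+n≰n (subst (ℕ._≤ k) (inj (ℕP.m≤n⇒m≤1+n i≤k) ℕP.≤-refl gi≡g1+k) i≤k)

  offline-hit : ∀ k → InjectiveUpTo k g → (L : Load m) → ∀ {j} → j ℕ.≤ k →
    offline L (countdown f k) (assignment k) (g j) ≡ L (g j) ⊔ f j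
  offline-hit zero    inj L z≤n = update-hit L (f 0) (g 0)
  offline-hit (suc k) inj L j≤1+k with ℕP.m≤n⇒m<n∨m≡n j≤1+k
  ... | inj₂ refl =
    trans (offline-miss k _ (g (suc k)) (distinct inj)) (update-hit L (f (suc k)) (g (suc k)))
  ... | inj₁ (s≤s j≤k) =
    trans (offline-hit k (λ i≤k j≤k → inj (ℕP.m≤n⇒m≤1+n i≤k) (ℕP.m≤n⇒m≤1+n j≤k)) _ j≤k)
          (cong (_⊔ f _) (update-miss L (f (suc k)) (distinct inj j≤k)))

clamp : (n : ℕ) → ℕ → Fin (suc n)
clamp n       zero    = zero
clamp zero    (suc j) = zero
clamp (suc n) (suc j) = suc (clamp n j)

clamp-toℕ : ∀ n (u : Fin (suc n)) → clamp n (toℕ u) ≡ u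
clamp-toℕ n       zero    = refl
clamp-toℕ (suc n) (suc u) = cong suc (clamp-toℕ n u)

toℕ-clamp : ∀ n {j} → j ℕ.≤ n → toℕ (clamp n j) ≡ j
toℕ-clamp n       z≤n       = refl
toℕ-clamp (suc n) (s≤s j≤n) = cong suc (toℕ-clamp n j≤n)

clamp-injective : ∀ n → InjectiveUpTo n (clamp n)
clamp-injective n {i} {j} i≤n j≤n ci≡cj =
  trans (sym (toℕ-clamp n i≤n)) (trans (cong toℕ ci≡cj) (toℕ-clamp n j≤n))

GreedyGap : ℚ → Set
GreedyGap ε =
  Σ ℕ λ m → Σ (Fin m → ℚ) λ s → (∀ u → 0ℚ < s u) ×
  Σ ℕ λ n → Σ (Vec ℚ n) λ ws → All (λ w → 0ℚ < w) ws ×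
  Σ (Load m) λ Lg → GreedyRun s emptyLoad ws Lg ×
  Σ (Vec (Maybe (Fin m)) n) λ σ →
    (0ℚ < value s (offline emptyLoad ws σ)) ×
    (((1ℚ + 1ℚ) - ε) * value s Lg ≤ value s (offline emptyLoad ws σ))

module Instance (x : ℚ) (0<x : 0ℚ < x) (x≤½ : x ≤ ½) (n : ℕ) where

  a : ℚ
  a = 1ℚ - x

  ½≤a : ½ ≤ a
  ½≤a = sub-antimonoʳ 1ℚ x≤½

  0<a : 0ℚ < a
  0<a = <-≤-trans (positive⁻¹ ½) ½≤a

  a≤1 : a ≤ 1ℚ
  a≤1 = ≤-trans (sub-antimonoʳ 1ℚ (<⇒≤ 0<x)) (≤-reflexive (+-identityʳ 1ℚ))

  speed : Fin (suc n) → ℚ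
  speed zero    = 1ℚ
  speed (suc _) = x

  speed-pos : ∀ u → 0ℚ < speed u
  speed-pos zero    = 0<1
  speed-pos (suc _) = 0<x

  record OnlyFast (c : ℚ) (L : Load (suc n)) : Set where
    constructor onlyFast
    field
      fast-load  : L zero ≡ c
      slow-empty : ∀ i → L (suc i) ≡ 0ℚ

  value-onlyFast : ∀ {c L} → OnlyFast c L → value speed L ≡ c
  value-onlyFast {c} {L} (onlyFast L₀≡c rest≡0) = begin
    1ℚ * L zero + sumFin n (λ i → x * L (suc i))
      ≡⟨ cong₂ _+_ (cong (1ℚ *_) L₀≡c) (sumFin-zero n (λ i → trans (cong (x *_) (rest≡0 i)) (*-zeroʳ x))) ⟩
    1ℚ * c + 0ℚ
      ≡⟨ trans (+-identityʳ (1ℚ * c)) (*-identityˡ c) ⟩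
    c ∎
    where open ≡-Reasoning

  onlyFast-update : ∀ {c L w} → OnlyFast c L → c ≤ w → OnlyFast w (update L w (just zero))
  onlyFast-update (onlyFast L₀≡c rest≡0) c≤w =
    onlyFast (trans (cong (_⊔ _) L₀≡c) (p≤q⇒p⊔q≡q c≤w)) rest≡0

  -- If the fast machine holds at most a·w, then adding w to it gains at least
  -- x·w, which is the gain on any (empty) slow machine: a valid greedy choice.
  fast-is-greedy : ∀ {c L w} → OnlyFast c L → 0ℚ < w → c ≤ a * w → GreedyChoice speed L w (just zero)
  fast-is-greedy {c} {L} {w} (onlyFast L₀≡c rest≡0) 0<w c≤aw =
    assign zero (<-≤-trans (*-pos 0<x 0<w) x·w≤fast) fast-is-max
    where
    open ≤-Reasoning
    x·w≤fast : x * w ≤ gain speed L w zero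
    x·w≤fast = begin
      x * w                      ≡⟨ solve 2 (λ x w → x :* w := con 1ℚ :* w :- con 1ℚ :* ((con 1ℚ :- x) :* w))
                                             refl x w ⟩
      1ℚ * w - 1ℚ * (a * w)      ≤⟨ sub-antimonoʳ (1ℚ * w) (*-monoˡ-≤-nonNeg 1ℚ c≤aw) ⟩
      1ℚ * w - 1ℚ * c            ≡⟨ cong (λ z → 1ℚ * w - 1ℚ * z) (sym L₀≡c) ⟩
      gain speed L w zero        ∎
    fast-is-max : ∀ u → gain speed L w u ≤ gain speed L w zero
    fast-is-max zero    = ≤-refl
    fast-is-max (suc i) = begin
      x * w - x * L (suc i)      ≡⟨ cong (λ z → x * w - x * z) (rest≡0 i) ⟩
      x * w - x * 0ℚ             ≡⟨ solve 2 (λ x w → x :* w :- x :* con 0ℚ := x :* w) refl x w ⟩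
      x * w                      ≤⟨ x·w≤fast ⟩
      gain speed L w zero        ∎

  below-job : ∀ {c w} → 0ℚ < w → c ≤ a * w → c ≤ w
  below-job {w = w} 0<w c≤aw = ≤-trans c≤aw
    (≤-trans (*-monoʳ-≤-nonNeg w {{nonNegative (<⇒≤ 0<w)}} a≤1) (≤-reflexive (*-identityˡ w)))

  greedy-stays-fast : (f : ℕ → ℚ) → (∀ j → 0ℚ < f j) → (∀ j → f (suc j) ≤ a * f j) →
    ∀ k {c L} → OnlyFast c L → c ≤ a * f k →
    Σ (Load (suc n)) λ Lg → GreedyRun speed L (countdown f k) Lg × OnlyFast (f 0) Lg
  greedy-stays-fast f f>0 grow zero {L = L} fast c≤af₀ =
    update L (f 0) (just zero) ,
    step (fast-is-greedy fast (f>0 0) c≤af₀) done ,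
    onlyFast-update fast (below-job (f>0 0) c≤af₀)
  greedy-stays-fast f f>0 grow (suc k) fast c≤af
    with greedy-stays-fast f f>0 grow k (onlyFast-update fast (below-job (f>0 (suc k)) c≤af)) (grow k)
  ... | Lg , run , fastᵍ = Lg , step (fast-is-greedy fast (f>0 (suc k)) c≤af) run , fastᵍ

  jobs : Vec ℚ (suc n)
  jobs = countdown (a ^_) n

  jobs-pos : All (λ w → 0ℚ < w) jobs
  jobs-pos = countdown-all (^-pos 0<a) n

  greedy-earns-one : Σ (Load (suc n)) λ Lg → GreedyRun speed emptyLoad jobs Lg × (value speed Lg ≡ 1ℚ)
  greedy-earns-one
    with greedy-stays-fast (a ^_) (^-pos 0<a) (λ _ → ≤-refl) n (onlyFast refl (λ _ → refl))
           (*-nonneg (<⇒≤ 0<a) (^-nonneg (<⇒≤ 0<a) n))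
  ... | Lg , run , fast = Lg , run , value-onlyFast fast

  open OfflineLoads (a ^_) (clamp n)

  optimal : Vec (Maybe (Fin (suc n))) (suc n)
  optimal = assignment n

  optimal-load : ∀ u → offline emptyLoad jobs optimal u ≡ a ^ toℕ u
  optimal-load u = begin
    offline emptyLoad jobs optimal u
      ≡⟨ cong (offline emptyLoad jobs optimal) (sym (clamp-toℕ n u)) ⟩
    offline emptyLoad jobs optimal (clamp n (toℕ u))
      ≡⟨ offline-hit n (clamp-injective n) emptyLoad (toℕ≤pred[n] u) ⟩
    0ℚ ⊔ a ^ toℕ u
      ≡⟨ p≤q⇒p⊔q≡q (^-nonneg (<⇒≤ 0<a) (toℕ u)) ⟩
    a ^ toℕ u ∎
    where open ≡-Reasoning

  optimal-value : value speed (offline emptyLoad jobs optimal) ≡ 1ℚ * 1ℚ + (a - a * a ^ n)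
  optimal-value = trans (sumFin-cong (suc n) (λ u → cong (speed u *_) (optimal-load u)))
                        (cong (1ℚ * 1ℚ +_) (geometric x a n))

  optimal-lower : a ^ suc n ≤ x → (1ℚ + 1ℚ) - (x + x) ≤ value speed (offline emptyLoad jobs optimal)
  optimal-lower aⁿ⁺¹≤x = begin
    (1ℚ + 1ℚ) - (x + x)    ≡⟨ solve 1 (λ x → (con 1ℚ :+ con 1ℚ) :- (x :+ x)
                                           := con 1ℚ :* con 1ℚ :+ ((con 1ℚ :- x) :- x)) refl x ⟩
    1ℚ * 1ℚ + (a - x)      ≤⟨ +-monoʳ-≤ (1ℚ * 1ℚ) (sub-antimonoʳ a aⁿ⁺¹≤x) ⟩
    1ℚ * 1ℚ + (a - a ^ suc n) ≡⟨ sym optimal-value ⟩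
    value speed (offline emptyLoad jobs optimal) ∎
    where open ≤-Reasoning

  greedy-gap : a ^ suc n ≤ x → ∀ ε → x + x ≤ ε → GreedyGap ε
  greedy-gap aⁿ⁺¹≤x ε 2x≤ε with greedy-earns-one
  ... | Lg , run , greedy≡1 =
    suc n , speed , speed-pos , suc n , jobs , jobs-pos , Lg , run , optimal , optimal-pos , ratio
    where
    open ≤-Reasoning
    optimal-pos : 0ℚ < value speed (offline emptyLoad jobs optimal)
    optimal-pos = begin-strict
      0ℚ                    <⟨ 0<1 ⟩
      (1ℚ + 1ℚ) - (½ + ½)   ≤⟨ sub-antimonoʳ (1ℚ + 1ℚ) (+-mono-≤ x≤½ x≤½) ⟩
      (1ℚ + 1ℚ) - (x + x)   ≤⟨ optimal-lower aⁿ⁺¹≤x ⟩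
      value speed (offline emptyLoad jobs optimal) ∎
    ratio : ((1ℚ + 1ℚ) - ε) * value speed Lg ≤ value speed (offline emptyLoad jobs optimal)
    ratio = begin
      ((1ℚ + 1ℚ) - ε) * value speed Lg   ≡⟨ trans (cong (((1ℚ + 1ℚ) - ε) *_) greedy≡1) (*-identityʳ _) ⟩
      (1ℚ + 1ℚ) - ε                      ≤⟨ sub-antimonoʳ (1ℚ + 1ℚ) 2x≤ε ⟩
      (1ℚ + 1ℚ) - (x + x)                ≤⟨ optimal-lower aⁿ⁺¹≤x ⟩
      value speed (offline emptyLoad jobs optimal) ∎

small-enough : ∀ ε → 0ℚ < ε → Σ ℚ λ x → (0ℚ < x) × (x ≤ ½) × (x + x ≤ ε)
small-enough ε 0<ε with ≤-total ε 1ℚ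
... | inj₁ ε≤1 =
  ½ * ε , *-pos (positive⁻¹ ½) 0<ε ,
  ≤-trans (*-monoˡ-≤-nonNeg ½ ε≤1) (≤-reflexive (*-identityʳ ½)) ,
  ≤-reflexive (solve 1 (λ e → con ½ :* e :+ con ½ :* e := e) refl ε)
... | inj₂ 1≤ε = ½ , positive⁻¹ ½ , ≤-refl , 1≤ε

theorem1 : (ε : ℚ) → 0ℚ < ε →
    Σ ℕ λ m → Σ (Fin m → ℚ) λ s → (∀ u → 0ℚ < s u) ×
    Σ ℕ λ n → Σ (Vec ℚ n) λ ws → All (λ w → 0ℚ < w) ws ×
    Σ (Load m) λ Lg → GreedyRun s emptyLoad ws Lg ×
    Σ (Vec (Maybe (Fin m)) n) λ σ →
    (0ℚ < value s (offline emptyLoad ws σ)) ×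
    (((1ℚ + 1ℚ) - ε) * value s Lg ≤ value s (offline emptyLoad ws σ))
theorem1 ε 0<ε =
  let (x , 0<x , x≤½ , 2x≤ε) = small-enough ε 0<ε
      x≤1 = ≤-trans x≤½ ½≤1
      (n , 1≤[n+1]x²) = archimedean (x * x) (*-pos 0<x 0<x)
      aⁿ⁺¹≤x = power-small (<⇒≤ 0<x) x≤1 (suc n) 1≤[n+1]x²
  in Instance.greedy-gap x 0<x x≤½ n aⁿ⁺¹≤x ε 2x≤ε
  where
  ½≤1 : ½ ≤ 1ℚ
  ½≤1 = *≤* (+≤+ (s≤s z≤n))
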